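{- Let $q$ be a power of an odd prime, let $F,H,R\in\mathbb{F}_q[T]$ be monic with $F\mid R$, and let $z$ be a non-negative integer with $z<\deg(R)$. Then \[ \sum_{\substack{A,B \text{ monic}\\ \deg(AB)=z\\ AH\equiv B \ (\mathrm{mod}\ F)\\ AH\neq B\\ (ABH,R)=1}}\frac{1}{|AB|^{\frac{1}{2}}}\ll\frac{q^{\frac{z}{2}}(z+1)|H|}{|F|}. \]
   Context: For $f\in\mathbb{F}_q[T]$, $|f|=q^{\deg(f)}$; $(\cdot,\cdot)$ denotes the monic gcd. -}

module Defs where

open import Level using (Level; _⊔_; 0ℓ) renaming (suc to lsuc)
open import Algebra.Bundles using (CommutativeRing)
open import Data.Nat using (ℕ; _≤_; _^_) renaming (_+_ to _+ℕ_)
open import Data.Nat.Primality using (Prime)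
open import Data.Product using (Σ; _×_; _,_; proj₁)
open import Data.List using (List; []; _∷_; map; length; _++_; [_])
open import Data.List.Relation.Unary.All using (All)
open import Data.List.Relation.Unary.Any using (Any)
open import Data.List.Relation.Unary.AllPairs using (AllPairs)
open import Data.Vec using (Vec; toList)
open import Relation.Nullary using (¬_)
open import Relation.Binary.PropositionalEquality using (_≡_)

OddPrimePower : ℕ → Set
OddPrimePower q = Σ ℕ λ p → Σ ℕ λ k → Prime p × ¬ (p ≡ 2) × 1 ≤ k × q ≡ p ^ k

record FiniteField (c ℓ : Level) : Set (lsuc (c ⊔ ℓ)) where
  field
    ring : CommutativeRing c ℓ
  open CommutativeRing ring
  field
    1≉0      : ¬ (1# ≈ 0#)
    inverse  : ∀ x → ¬ (x ≈ 0#) → Σ Carrier λ y → (x * y) ≈ 1#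
    elements : List Carrier
    complete : ∀ x → Any (x ≈_) elements
    distinct : AllPairs (λ x y → ¬ (x ≈ y)) elements

  size : ℕ
  size = length elements

module Over {c ℓ : Level} (K : FiniteField c ℓ) where
  open FiniteField K
  open CommutativeRing ring

  q : ℕ
  q = size

  -- polynomials as coefficient lists, lowest degree first
  Poly : Set c
  Poly = List Carrier

  _+ₚ_ : Poly → Poly → Poly
  []      +ₚ g       = g
  (a ∷ f) +ₚ []      = a ∷ f
  (a ∷ f) +ₚ (b ∷ g) = (a + b) ∷ (f +ₚ g)

  negₚ : Poly → Poly
  negₚ = map (λ x → - x)

  _-ₚ_ : Poly → Poly → Poly
  f -ₚ g = f +ₚ negₚ g

  _*ₚ_ : Poly → Poly → Poly
  []      *ₚ g = []
  (a ∷ f) *ₚ g = map (a *_) g +ₚ (0# ∷ (f *ₚ g))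

  oneₚ : Poly
  oneₚ = 1# ∷ []

  -- equality of polynomials (coefficientwise, ignoring trailing zeros)
  _≈ₚ_ : Poly → Poly → Set (c ⊔ ℓ)
  []      ≈ₚ g       = All (_≈ 0#) g
  (a ∷ f) ≈ₚ []      = All (_≈ 0#) (a ∷ f)
  (a ∷ f) ≈ₚ (b ∷ g) = (a ≈ b) × (f ≈ₚ g)

  _∣ₚ_ : Poly → Poly → Set (c ⊔ ℓ)
  d ∣ₚ f = Σ Poly λ e → f ≈ₚ (e *ₚ d)

  _≡_[mod_] : Poly → Poly → Poly → Set (c ⊔ ℓ)
  f ≡ g [mod m ] = m ∣ₚ (f -ₚ g)

  Coprime : Poly → Poly → Set (c ⊔ ℓ)
  Coprime f g = ∀ d → d ∣ₚ f → d ∣ₚ g → d ∣ₚ oneₚ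

  -- monic polynomials: degree d and the d lower coefficients
  Monic : Set c
  Monic = Σ ℕ (Vec Carrier)

  deg : Monic → ℕ
  deg = proj₁

  poly : Monic → Poly
  poly (d , v) = toList v ++ [ 1# ]

  ∣_∣ : Monic → ℕ
  ∣ f ∣ = q ^ deg f

  DistinctPair : Monic × Monic → Monic × Monic → Set (c ⊔ ℓ)
  DistinctPair (A , B) (A' , B') = ¬ ((poly A ≈ₚ poly A') × (poly B ≈ₚ poly B'))

  Admissible : (F H R : Monic) (z : ℕ) → Monic × Monic → Set (c ⊔ ℓ)
  Admissible F H R z (A , B) =
    (deg A +ℕ deg B ≡ z)
    × ((poly A *ₚ poly H) ≡ poly B [mod poly F ])
    × ¬ ((poly A *ₚ poly H) ≈ₚ poly B)
    × Coprime ((poly A *ₚ poly B) *ₚ poly H) (poly R)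

{-# OPTIONS --safe #-}

-- Sort the pairs by a = deg A, so that deg B = z - a: there are z + 1 classes, and a
-- pigeonhole argument bounds each class, because a pair is determined by few coefficients.
-- If deg B ≥ deg F, the pair is determined by A and the coefficients of B from index deg F on:
-- two candidates for B are both congruent to AH modulo F and agree from deg F on, and a
-- multiple of the monic F of degree < deg F vanishes. This leaves at most q^(z - deg F) pairs.
-- If deg B < deg F, the pair is determined by B and the coefficients of A from index deg F on:
-- (H, R) = 1 and F ∣ R give uF + vH = 1 by Euclid's algorithm, so AH ≡ B fixes A modulo F.
-- Moreover AH ≠ B forces deg F ≤ deg A + deg H, which leaves at most q^(z + deg H - deg F) pairs.
-- Hence (number of pairs) |F| ≤ 2 (z + 1) q^z |H|; every summand of the sum equals q^(-z/2).

module Submission where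

open import Defs
open import Level using (0ℓ; _⊔_)
open import Algebra.Bundles using (CommutativeRing; AbelianGroup; Semiring)
open import Algebra.Structures using (IsCommutativeRing; IsAbelianGroup)
import Algebra.Properties.CommutativeSemigroup as CommutativeSemigroupProperties
open import Data.Nat as ℕ using (ℕ; zero; suc; _∸_; _^_; _≤_; _<_; s≤s; z≤n)
open import Data.Nat.Properties as ℕ using (≤-trans; ≤-reflexive; ≤∧≢⇒<)
open import Data.Nat.Induction using (<-wellFounded)
open import Data.Nat.Tactic.RingSolver using (solve-∀)
open import Data.Fin as Fin using (Fin; finToFun; funToFin)
import Data.Fin.Properties as Fin
open import Data.Fin.Properties using (finToFun-funToFin)
open import Data.Product using (Σ; _×_; _,_; ∃; ∃₂; proj₁; proj₂)
open import Data.Sum using (_⊎_; inj₁; inj₂)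
open import Data.List using (List; []; _∷_; map; lookup; length; _++_; [_]; filter)
open import Data.List.Relation.Unary.All as All using (All; []; _∷_)
open import Data.List.Relation.Unary.Any as Any using (Any; here; there)
open import Data.List.Relation.Unary.Any.Properties using (lookup-index)
open import Data.List.Relation.Unary.AllPairs using (AllPairs; []; _∷_)
open import Data.Vec using (Vec; toList; []; _∷_)
open import Data.Vec.Properties using (length-toList)
open import Function using (_∘_)
open import Induction.WellFounded using (Acc; acc)
open import Relation.Binary.Bundles using (Setoid)
open import Relation.Binary.Structures using (IsEquivalence)
import Relation.Binary.Reasoning.Setoid as SetoidReasoning
import Relation.Binary.PropositionalEquality as ≡
open import Relation.Binary.PropositionalEquality using (_≡_)
open import Relation.Nullary using (¬_; yes; no; contradiction)
import Relation.Nullary.Decidable as Dec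
open import Relation.Unary using (Pred; _∩_; ∁)

module ListCounting where

  open import Data.Bool using (true; false)
  open import Data.Nat using (_+_; _*_)
  open import Data.Nat.Properties using (module ≤-Reasoning; ≰⇒>; +-mono-≤; *-distribʳ-+; +-suc; _≤?_)
  open import Data.Fin.Properties using (pigeonhole)
  open import Data.List.Membership.Propositional.Properties using (∈-lookup)
  import Data.List.Relation.Unary.All.Properties as All
  import Data.List.Relation.Unary.AllPairs.Properties as AllPairs
  open import Relation.Binary.Core using (Rel)
  open import Relation.Binary.PropositionalEquality using (refl; cong; trans)
  open import Relation.Nullary using (does)
  open import Relation.Unary using (Decidable)
  open import Relation.Unary.Properties using (∁?)

  module _ {a p} {X : Set a} {P : Pred X p} (P? : Decidable P) where

    length-filter+length-filter-∁ : ∀ xs → length (filter P? xs) + length (filter (∁? P?) xs) ≡ length xs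
    length-filter+length-filter-∁ []       = refl
    length-filter+length-filter-∁ (x ∷ xs) with ih ← length-filter+length-filter-∁ xs | does (P? x)
    ... | true  = cong suc ih
    ... | false = trans (+-suc _ _) (cong suc ih)

  module _ {a r} {X : Set a} {R : Rel X r} where

    AllPairs-lookup : ∀ {xs} → AllPairs R xs → ∀ {i j} → i Fin.< j → R (lookup xs i) (lookup xs j)
    AllPairs-lookup (Rx ∷ _)   {Fin.zero}  {Fin.suc j} _         = All.lookup Rx (∈-lookup j)
    AllPairs-lookup (_ ∷ Rxs) {Fin.suc i} {Fin.suc j} (s≤s i<j) = AllPairs-lookup Rxs i<j

    separating-code⇒length≤ : ∀ {p} {P : Pred X p} {n} (code : X → Fin n) →
      (∀ {x y} → P x → P y → code x ≡ code y → ¬ R x y) →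
      ∀ {xs} → AllPairs R xs → All P xs → length xs ≤ n
    separating-code⇒length≤ {n = n} code separates {xs} Rxs Pxs with length xs ≤? n
    ... | yes len≤n = len≤n
    ... | no  len≰n =
      let i , j , i<j , same-code = pigeonhole (≰⇒> len≰n) (λ i → code (lookup xs i))
      in contradiction (AllPairs-lookup Rxs i<j)
           (separates (All.lookup Pxs (∈-lookup i)) (All.lookup Pxs (∈-lookup j)) same-code)

    split-count : ∀ {p s} {P : Pred X p} {S : Pred X s} (S? : Decidable S) {w T U} →
      (∀ {ys} → AllPairs R ys → All (P ∩ S) ys → length ys * w ≤ T) →
      (∀ {ys} → AllPairs R ys → All (P ∩ ∁ S) ys → length ys * w ≤ U) →
      ∀ {xs} → AllPairs R xs → All P xs → length xs * w ≤ T + U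
    split-count {P = P} S? {w} {T} {U} bound-S bound-∁S {xs} Rxs Pxs = begin
      length xs * w                                            ≡⟨ cong (_* w) (length-filter+length-filter-∁ S? xs) ⟨
      (length (filter S? xs) + length (filter (∁? S?) xs)) * w ≡⟨ *-distribʳ-+ w (length (filter S? xs)) _ ⟩
      length (filter S? xs) * w + length (filter (∁? S?) xs) * w
        ≤⟨ +-mono-≤ (bound-S (AllPairs.filter⁺ S? Rxs) (part S?))
                    (bound-∁S (AllPairs.filter⁺ (∁? S?) Rxs) (part (∁? S?))) ⟩
      T + U ∎
      where
      open ≤-Reasoning
      part : ∀ {s} {S : Pred X s} (S? : Decidable S) → All (P ∩ S) (filter S? xs)
      part S? = All.zip (All.filter⁺ S? Pxs , All.all-filter S? xs)

    key-count : ∀ {p} {P : Pred X p} (key : X → ℕ) {w T : ℕ} →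
      (∀ k {ys} → AllPairs R ys → All (P ∩ (λ x → key x ≡ k)) ys → length ys * w ≤ T) →
      ∀ n {xs} → AllPairs R xs → All (P ∩ (λ x → key x < n)) xs → length xs * w ≤ n * T
    key-count key bound zero    {[]}    _   _                   = z≤n
    key-count key bound zero    {_ ∷ _} _   ((_ , ()) ∷ _)
    key-count {P = P} key bound (suc n) Rxs Pxs =
      split-count {P = P ∩ (λ x → key x < suc n)} (λ x → key x ℕ.≟ n)
        (λ Rys Pys → bound n Rys (All.map (λ { ((px , _) , k≡n) → px , k≡n }) Pys))
        (λ Rys Pys → key-count key bound n Rys
          (All.map (λ { ((px , k<1+n) , k≢n) → px , ≤∧≢⇒< (ℕ.s≤s⁻¹ k<1+n) k≢n }) Pys))
        Rxs Pxs

open ListCounting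

m∸n+n≤o : ∀ {m n o} → m ≤ o → n ≤ o → m ∸ n ℕ.+ n ≤ o
m∸n+n≤o {m} {n} m≤o n≤o with n ℕ.≤? m
... | yes n≤m = ≤-trans (≤-reflexive (ℕ.m∸n+n≡m n≤m)) m≤o
... | no  n≰m = ≤-trans (≤-reflexive (≡.cong (ℕ._+ n) (ℕ.m≤n⇒m∸n≡0 (ℕ.<⇒≤ (ℕ.≰⇒> n≰m))))) n≤o

module CommutativeRingDivisibility {a ℓ} (R : CommutativeRing a ℓ) where

  open CommutativeRing R
  open import Algebra.Properties.Semiring.Divisibility semiring public
  open import Algebra.Definitions.RawSemiring (Semiring.rawSemiring semiring) public using (Coprime)
  open import Algebra.Properties.Ring ring using (-‿distribˡ-*; [y-z]x≈yx-zx)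
  open import Algebra.Properties.AbelianGroup +-abelianGroup using (⁻¹-anti-homo‿-)
  open import Algebra.Properties.CommutativeSemigroup +-commutativeSemigroup using (interchange)
  open import Algebra.Properties.CommutativeSemigroup *-commutativeSemigroup using (x∙yz≈y∙xz)
  open import Relation.Binary.Reasoning.Setoid setoid

  infix 4 _≡_[mod_]

  -- A record rather than an abbreviation of d ∣ x - y, so that x, y and d are inferable.
  record _≡_[mod_] (x y d : Carrier) : Set (a ⊔ ℓ) where
    constructor mk≡mod
    field ∣-difference : d ∣ x - y

  ∣x∣y⇒∣x+y : ∀ {d x y} → d ∣ x → d ∣ y → d ∣ x + y
  ∣x∣y⇒∣x+y {d} (p , pd≈x) (q , qd≈y) = p + q , trans (distribʳ d p q) (+-cong pd≈x qd≈y)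

  ∣x⇒∣-x : ∀ {d x} → d ∣ x → d ∣ - x
  ∣x⇒∣-x {d} (p , pd≈x) = - p , trans (sym (-‿distribˡ-* p d)) (-‿cong pd≈x)

  ≡-mod-sym : ∀ {d x y} → x ≡ y [mod d ] → y ≡ x [mod d ]
  ≡-mod-sym (mk≡mod d∣x-y) = mk≡mod (∣ʳ-respʳ-≈ (⁻¹-anti-homo‿- _ _) (∣x⇒∣-x d∣x-y))

  ≡-mod-trans : ∀ {d x y z} → x ≡ y [mod d ] → y ≡ z [mod d ] → x ≡ z [mod d ]
  ≡-mod-trans {x = x} {y} {z} (mk≡mod d∣x-y) (mk≡mod d∣y-z) =
    mk≡mod (∣ʳ-respʳ-≈ telescope (∣x∣y⇒∣x+y d∣x-y d∣y-z))
    where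
    telescope : (x - y) + (y - z) ≈ x - z
    telescope = begin
      (x - y) + (y - z)   ≈⟨ interchange x (- y) y (- z) ⟩
      (x + y) + (- y - z) ≈⟨ +-assoc x y (- y - z) ⟩
      x + (y + (- y - z)) ≈⟨ +-congˡ (+-assoc y (- y) (- z)) ⟨
      x + ((y - y) - z)   ≈⟨ +-congˡ (+-congʳ (-‿inverseʳ y)) ⟩
      x + (0# - z)        ≈⟨ +-congˡ (+-identityˡ (- z)) ⟩
      x - z               ∎

  ≡-mod-respˡ : ∀ {d x x′ y} → x ≈ x′ → x ≡ y [mod d ] → x′ ≡ y [mod d ]
  ≡-mod-respˡ x≈x′ (mk≡mod d∣x-y) = mk≡mod (∣ʳ-respʳ-≈ (+-congʳ x≈x′) d∣x-y)

  ≡-mod-respʳ : ∀ {d x y y′} → y ≈ y′ → x ≡ y [mod d ] → x ≡ y′ [mod d ]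
  ≡-mod-respʳ y≈y′ (mk≡mod d∣x-y) = mk≡mod (∣ʳ-respʳ-≈ (+-congˡ (-‿cong y≈y′)) d∣x-y)

  Combination : Carrier → Carrier → Carrier → Set (a ⊔ ℓ)
  Combination f g x = ∃₂ λ u v → u * f + v * g ≈ x

  bezout-divisor : ∀ {d h x} → Combination d h 1# → d ∣ x * h → d ∣ x
  bezout-divisor {d} {h} {x} (u , v , ud+vh≈1) d∣xh =
    ∣ʳ-respʳ-≈ expand (∣x∣y⇒∣x+y (x∣ʳyx d (x * u)) (x∣ʳy⇒x∣ʳzy v d∣xh))
    where
    expand : (x * u) * d + v * (x * h) ≈ x
    expand = begin
      (x * u) * d + v * (x * h) ≈⟨ +-cong (*-assoc x u d) (x∙yz≈y∙xz v x h) ⟩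
      x * (u * d) + x * (v * h) ≈⟨ distribˡ x (u * d) (v * h) ⟨
      x * (u * d + v * h)       ≈⟨ *-congˡ ud+vh≈1 ⟩
      x * 1#                    ≈⟨ *-identityʳ x ⟩
      x                         ∎

  ≡-mod-cancelʳ : ∀ {d h x y} → Combination d h 1# → x * h ≡ y * h [mod d ] → x ≡ y [mod d ]
  ≡-mod-cancelʳ bezout (mk≡mod d∣xh-yh) =
    mk≡mod (bezout-divisor bezout (∣ʳ-respʳ-≈ (sym ([y-z]x≈yx-zx _ _ _)) d∣xh-yh))

  module _ {f g q r} (division : f ≈ q * g + r) where

    euclid-coprime : Coprime f g → Coprime g r
    euclid-coprime coprime d∣g d∣r = coprime (∣ʳ-respʳ-≈ (sym division) (∣x∣y⇒∣x+y (x∣ʳy⇒x∣ʳzy q d∣g) d∣r)) d∣g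

    euclid-combination : ∀ {x} → Combination g r x → Combination f g x
    euclid-combination {x} (u , v , ug+vr≈x) = v , u - v * q , (begin
      v * f + (u - v * q) * g                   ≈⟨ +-cong (*-congˡ division) ([y-z]x≈yx-zx g u (v * q)) ⟩
      v * (q * g + r) + (u * g - v * q * g)     ≈⟨ +-congʳ (trans (distribˡ v (q * g) r) (+-congʳ (sym (*-assoc v q g)))) ⟩
      (v * q * g + v * r) + (u * g - v * q * g) ≈⟨ +-congʳ (+-comm _ _) ⟩
      (v * r + v * q * g) + (u * g - v * q * g) ≈⟨ interchange (v * r) _ (u * g) _ ⟩
      (v * r + u * g) + (v * q * g - v * q * g) ≈⟨ +-cong (+-comm _ _) (-‿inverseʳ _) ⟩
      (u * g + v * r) + 0#                      ≈⟨ +-identityʳ _ ⟩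
      u * g + v * r                             ≈⟨ ug+vr≈x ⟩
      x                                         ∎)

module Polynomials {c ℓ} (K : FiniteField c ℓ) where

  open import Relation.Binary.Definitions using (Decidable; tri<; tri≈; tri>)
  open CommutativeRing (FiniteField.ring K) hiding (zero)
  open FiniteField K using (elements; complete; distinct; inverse; 1≉0)
  open import Algebra.Properties.Ring ring using (-0#≈0#)
  open Over K using (q; Poly; Monic; deg; poly; Admissible; DistinctPair; _+ₚ_; negₚ; _*ₚ_; oneₚ; _≈ₚ_; _∣ₚ_)

  index : Carrier → Fin q
  index x = Any.index (complete x)

  index-injective : ∀ {x y} → index x ≡ index y → x ≈ y
  index-injective {x} {y} same = trans (lookup-index (complete x))
    (trans (reflexive (≡.cong (lookup elements) same)) (sym (lookup-index (complete y))))

  index-cong : ∀ {x y} → x ≈ y → index x ≡ index y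
  index-cong {x} {y} x≈y with Fin.<-cmp (index x) (index y)
  ... | tri≈ _ same _ = same
  ... | tri< i<j _ _  = contradiction (trans (sym (lookup-index (complete x))) (trans x≈y (lookup-index (complete y))))
                          (AllPairs-lookup distinct i<j)
  ... | tri> _ _ j<i  = contradiction (trans (sym (lookup-index (complete y))) (trans (sym x≈y) (lookup-index (complete x))))
                          (AllPairs-lookup distinct j<i)

  _≟_ : Decidable _≈_
  x ≟ y = Dec.map′ index-injective index-cong (index x Fin.≟ index y)

  encode : ∀ {n} → (Fin n → Carrier) → Fin (q ^ n)
  encode u = funToFin (index ∘ u)

  encode-injective : ∀ {n} {u v : Fin n → Carrier} → encode u ≡ encode v → ∀ i → u i ≈ v i
  encode-injective {u = u} {v} same i = index-injective (begin
    index (u i)                  ≡⟨ finToFun-funToFin (index ∘ u) i ⟨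
    finToFun (encode u) i        ≡⟨ ≡.cong (λ e → finToFun e i) same ⟩
    finToFun (encode v) i        ≡⟨ finToFun-funToFin (index ∘ v) i ⟩
    index (v i)                  ∎)
    where open ≡.≡-Reasoning

  0<q : 0 < q
  0<q = nonempty (complete 0#)
    where
    nonempty : ∀ {xs} → Any (0# ≈_) xs → 0 < length xs
    nonempty (here _)  = ℕ.z<s
    nonempty (there _) = ℕ.z<s

  -- The commutative ring of polynomials

  coeff : Poly → ℕ → Carrier
  coeff []      _       = 0#
  coeff (a ∷ f) zero    = a
  coeff (a ∷ f) (suc k) = coeff f k

  infix 4 _≋_
  record _≋_ (f g : Poly) : Set ℓ where
    constructor mk≋
    field coeff-≈ : ∀ k → coeff f k ≈ coeff g k
  open _≋_

  ≋-isEquivalence : IsEquivalence _≋_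
  ≋-isEquivalence = record
    { refl  = mk≋ λ _ → refl
    ; sym   = λ f≋g → mk≋ λ k → sym (coeff-≈ f≋g k)
    ; trans = λ f≋g g≋h → mk≋ λ k → trans (coeff-≈ f≋g k) (coeff-≈ g≋h k)
    }

  ≋-setoid : Setoid c ℓ
  ≋-setoid = record { isEquivalence = ≋-isEquivalence }

  open IsEquivalence ≋-isEquivalence using () renaming (refl to ≋-refl; sym to ≋-sym; trans to ≋-trans)

  infix 4 _≋_from_
  _≋_from_ : Poly → Poly → ℕ → Set ℓ
  f ≋ g from s = ∀ k → s ≤ k → coeff f k ≈ coeff g k

  All≈0⇒coeff≈0 : ∀ {f} → All (_≈ 0#) f → ∀ k → coeff f k ≈ 0#
  All≈0⇒coeff≈0 []         _       = refl
  All≈0⇒coeff≈0 (a≈0 ∷ _)  zero    = a≈0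
  All≈0⇒coeff≈0 (_ ∷ f≈0)  (suc k) = All≈0⇒coeff≈0 f≈0 k

  coeff≈0⇒All≈0 : ∀ f → (∀ k → coeff f k ≈ 0#) → All (_≈ 0#) f
  coeff≈0⇒All≈0 []      _   = []
  coeff≈0⇒All≈0 (a ∷ f) f≈0 = f≈0 zero ∷ coeff≈0⇒All≈0 f (λ k → f≈0 (suc k))

  ≈ₚ⇒≋ : ∀ {f g} → f ≈ₚ g → f ≋ g
  ≈ₚ⇒≋ {f} {g} = mk≋ ∘ pointwise f g
    where
    pointwise : ∀ f g → f ≈ₚ g → ∀ k → coeff f k ≈ coeff g k
    pointwise []      g       g≈0           k       = sym (All≈0⇒coeff≈0 g≈0 k)
    pointwise (a ∷ f) []      f≈0           k       = All≈0⇒coeff≈0 f≈0 k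
    pointwise (a ∷ f) (b ∷ g) (a≈b , _)     zero    = a≈b
    pointwise (a ∷ f) (b ∷ g) (_ , f≈ₚg)    (suc k) = pointwise f g f≈ₚg k

  ≋⇒≈ₚ : ∀ {f g} → f ≋ g → f ≈ₚ g
  ≋⇒≈ₚ {f} {g} = fromPointwise f g ∘ coeff-≈
    where
    fromPointwise : ∀ f g → (∀ k → coeff f k ≈ coeff g k) → f ≈ₚ g
    fromPointwise []      g       f≈g = coeff≈0⇒All≈0 g (λ k → sym (f≈g k))
    fromPointwise (a ∷ f) []      f≈g = coeff≈0⇒All≈0 (a ∷ f) f≈g
    fromPointwise (a ∷ f) (b ∷ g) f≈g = f≈g zero , fromPointwise f g (λ k → f≈g (suc k))

  infixr 30 _·ₚ_
  _·ₚ_ : Carrier → Poly → Poly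
  a ·ₚ f = map (a *_) f

  coeff-+ₚ : ∀ f g k → coeff (f +ₚ g) k ≈ coeff f k + coeff g k
  coeff-+ₚ []      g       k       = sym (+-identityˡ _)
  coeff-+ₚ (a ∷ f) []      k       = sym (+-identityʳ _)
  coeff-+ₚ (a ∷ f) (b ∷ g) zero    = refl
  coeff-+ₚ (a ∷ f) (b ∷ g) (suc k) = coeff-+ₚ f g k

  coeff-·ₚ : ∀ a f k → coeff (a ·ₚ f) k ≈ a * coeff f k
  coeff-·ₚ a []      k       = sym (zeroʳ a)
  coeff-·ₚ a (b ∷ f) zero    = refl
  coeff-·ₚ a (b ∷ f) (suc k) = coeff-·ₚ a f k

  coeff-negₚ : ∀ f k → coeff (negₚ f) k ≈ - coeff f k
  coeff-negₚ []      k       = sym -0#≈0#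
  coeff-negₚ (b ∷ f) zero    = refl
  coeff-negₚ (b ∷ f) (suc k) = coeff-negₚ f k

  coeffwise : ∀ {f g} {φ : ℕ → Carrier} → (∀ k → coeff f k ≈ φ k) → (∀ k → coeff g k ≈ φ k) → f ≋ g
  coeffwise f≈φ g≈φ = mk≋ λ k → trans (f≈φ k) (sym (g≈φ k))

  +ₚ-cong : ∀ {f f′ g g′} → f ≋ f′ → g ≋ g′ → f +ₚ g ≋ f′ +ₚ g′
  +ₚ-cong {f} {f′} {g} {g′} f≋f′ g≋g′ =
    coeffwise (λ k → trans (coeff-+ₚ f g k) (+-cong (coeff-≈ f≋f′ k) (coeff-≈ g≋g′ k))) (coeff-+ₚ f′ g′)

  +ₚ-assoc : ∀ f g h → (f +ₚ g) +ₚ h ≋ f +ₚ (g +ₚ h)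
  +ₚ-assoc f g h = coeffwise
    (λ k → trans (coeff-+ₚ (f +ₚ g) h k) (trans (+-congʳ (coeff-+ₚ f g k)) (+-assoc _ _ _)))
    (λ k → trans (coeff-+ₚ f (g +ₚ h) k) (+-congˡ (coeff-+ₚ g h k)))

  +ₚ-comm : ∀ f g → f +ₚ g ≋ g +ₚ f
  +ₚ-comm f g = coeffwise (λ k → trans (coeff-+ₚ f g k) (+-comm _ _)) (coeff-+ₚ g f)

  +ₚ-identityʳ : ∀ f → f +ₚ [] ≋ f
  +ₚ-identityʳ f = coeffwise (λ k → trans (coeff-+ₚ f [] k) (+-identityʳ _)) (λ _ → refl)

  negₚ-cong : ∀ {f g} → f ≋ g → negₚ f ≋ negₚ g
  negₚ-cong {f} {g} f≋g = coeffwise (λ k → trans (coeff-negₚ f k) (-‿cong (coeff-≈ f≋g k))) (coeff-negₚ g)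

  negₚ-inverseˡ : ∀ f → negₚ f +ₚ f ≋ []
  negₚ-inverseˡ f = coeffwise
    (λ k → trans (coeff-+ₚ (negₚ f) f k) (trans (+-congʳ (coeff-negₚ f k)) (-‿inverseˡ _)))
    (λ _ → refl)

  negₚ-inverseʳ : ∀ f → f +ₚ negₚ f ≋ []
  negₚ-inverseʳ f = ≋-trans (+ₚ-comm f (negₚ f)) (negₚ-inverseˡ f)

  ·ₚ-cong : ∀ {a b f g} → a ≈ b → f ≋ g → a ·ₚ f ≋ b ·ₚ g
  ·ₚ-cong {a} {b} {f} {g} a≈b f≋g = coeffwise (λ k → trans (coeff-·ₚ a f k) (*-cong a≈b (coeff-≈ f≋g k))) (coeff-·ₚ b g)

  ·ₚ-zeroˡ : ∀ f → 0# ·ₚ f ≋ []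
  ·ₚ-zeroˡ f = coeffwise (λ k → trans (coeff-·ₚ 0# f k) (zeroˡ _)) (λ _ → refl)

  ·ₚ-identityˡ : ∀ f → 1# ·ₚ f ≋ f
  ·ₚ-identityˡ f = coeffwise (λ k → trans (coeff-·ₚ 1# f k) (*-identityˡ _)) (λ _ → refl)

  ·ₚ-distribˡ : ∀ a f g → a ·ₚ (f +ₚ g) ≋ a ·ₚ f +ₚ a ·ₚ g
  ·ₚ-distribˡ a f g = coeffwise
    (λ k → trans (coeff-·ₚ a (f +ₚ g) k) (trans (*-congˡ (coeff-+ₚ f g k)) (distribˡ a _ _)))
    (λ k → trans (coeff-+ₚ (a ·ₚ f) (a ·ₚ g) k) (+-cong (coeff-·ₚ a f k) (coeff-·ₚ a g k)))

  ·ₚ-distribʳ : ∀ a b f → (a + b) ·ₚ f ≋ a ·ₚ f +ₚ b ·ₚ f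
  ·ₚ-distribʳ a b f = coeffwise
    (λ k → trans (coeff-·ₚ (a + b) f k) (distribʳ _ a b))
    (λ k → trans (coeff-+ₚ (a ·ₚ f) (b ·ₚ f) k) (+-cong (coeff-·ₚ a f k) (coeff-·ₚ b f k)))

  ·ₚ-assoc : ∀ a b f → a ·ₚ b ·ₚ f ≋ (a * b) ·ₚ f
  ·ₚ-assoc a b f = coeffwise
    (λ k → trans (coeff-·ₚ a (b ·ₚ f) k) (trans (*-congˡ (coeff-·ₚ b f k)) (sym (*-assoc a b _))))
    (coeff-·ₚ (a * b) f)

  +ₚ-isAbelianGroup : IsAbelianGroup _≋_ _+ₚ_ [] negₚ
  +ₚ-isAbelianGroup = record
    { isGroup = record
      { isMonoid = record
        { isSemigroup = record
          { isMagma = record { isEquivalence = ≋-isEquivalence ; ∙-cong = +ₚ-cong }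
          ; assoc   = +ₚ-assoc
          }
        ; identity = (λ _ → ≋-refl) , +ₚ-identityʳ
        }
      ; inverse = negₚ-inverseˡ , negₚ-inverseʳ
      ; ⁻¹-cong = negₚ-cong
      }
    ; comm = +ₚ-comm
    }

  +ₚ-abelianGroup : AbelianGroup c ℓ
  +ₚ-abelianGroup = record { isAbelianGroup = +ₚ-isAbelianGroup }

  open CommutativeSemigroupProperties (AbelianGroup.commutativeSemigroup +ₚ-abelianGroup)
    using () renaming (interchange to +ₚ-interchange; x∙yz≈y∙xz to +ₚ-x∙yz≈y∙xz)

  ∷-cong : ∀ {a b f g} → a ≈ b → f ≋ g → a ∷ f ≋ b ∷ g
  ∷-cong a≈b f≋g = mk≋ λ { zero → a≈b ; (suc k) → coeff-≈ f≋g k }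

  0∷≋[] : ∀ {f} → f ≋ [] → 0# ∷ f ≋ []
  0∷≋[] f≋[] = mk≋ λ { zero → refl ; (suc k) → coeff-≈ f≋[] k }

  *ₚ-zeroʳ : ∀ f → f *ₚ [] ≋ []
  *ₚ-zeroʳ []      = ≋-refl
  *ₚ-zeroʳ (a ∷ f) = 0∷≋[] (*ₚ-zeroʳ f)

  *ₚ-congˡ : ∀ f {g g′} → g ≋ g′ → f *ₚ g ≋ f *ₚ g′
  *ₚ-congˡ []      g≋g′ = ≋-refl
  *ₚ-congˡ (a ∷ f) g≋g′ = +ₚ-cong (·ₚ-cong refl g≋g′) (∷-cong refl (*ₚ-congˡ f g≋g′))

  *ₚ-∷ʳ : ∀ f b g → f *ₚ (b ∷ g) ≋ b ·ₚ f +ₚ (0# ∷ f *ₚ g)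
  *ₚ-∷ʳ []      b g = ≋-sym (0∷≋[] ≋-refl)
  *ₚ-∷ʳ (a ∷ f) b g = ∷-cong (+-congʳ (*-comm a b)) (begin
    a ·ₚ g +ₚ (f *ₚ (b ∷ g))            ≈⟨ +ₚ-cong ≋-refl (*ₚ-∷ʳ f b g) ⟩
    a ·ₚ g +ₚ (b ·ₚ f +ₚ (0# ∷ f *ₚ g)) ≈⟨ +ₚ-x∙yz≈y∙xz (a ·ₚ g) (b ·ₚ f) _ ⟩
    b ·ₚ f +ₚ (a ·ₚ g +ₚ (0# ∷ f *ₚ g)) ∎)
    where open SetoidReasoning ≋-setoid

  *ₚ-comm : ∀ f g → f *ₚ g ≋ g *ₚ f
  *ₚ-comm []      g = ≋-sym (*ₚ-zeroʳ g)
  *ₚ-comm (a ∷ f) g = ≋-trans (+ₚ-cong ≋-refl (∷-cong refl (*ₚ-comm f g))) (≋-sym (*ₚ-∷ʳ g a f))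

  *ₚ-congʳ : ∀ {f f′} g → f ≋ f′ → f *ₚ g ≋ f′ *ₚ g
  *ₚ-congʳ {f} {f′} g f≋f′ = ≋-trans (*ₚ-comm f g) (≋-trans (*ₚ-congˡ g f≋f′) (*ₚ-comm g f′))

  *ₚ-distribʳ : ∀ h f g → (f +ₚ g) *ₚ h ≋ (f *ₚ h) +ₚ (g *ₚ h)
  *ₚ-distribʳ h []      g       = ≋-refl
  *ₚ-distribʳ h (a ∷ f) []      = ≋-sym (+ₚ-identityʳ _)
  *ₚ-distribʳ h (a ∷ f) (b ∷ g) = begin
    (a + b) ·ₚ h +ₚ (0# ∷ (f +ₚ g) *ₚ h)
      ≈⟨ +ₚ-cong (·ₚ-distribʳ a b h) (∷-cong (sym (+-identityʳ 0#)) (*ₚ-distribʳ h f g)) ⟩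
    (a ·ₚ h +ₚ b ·ₚ h) +ₚ ((0# ∷ f *ₚ h) +ₚ (0# ∷ g *ₚ h)) ≈⟨ +ₚ-interchange (a ·ₚ h) _ _ _ ⟩
    (a ·ₚ h +ₚ (0# ∷ f *ₚ h)) +ₚ (b ·ₚ h +ₚ (0# ∷ g *ₚ h)) ∎
    where open SetoidReasoning ≋-setoid

  *ₚ-distribˡ : ∀ h f g → h *ₚ (f +ₚ g) ≋ (h *ₚ f) +ₚ (h *ₚ g)
  *ₚ-distribˡ h f g = ≋-trans (*ₚ-comm h (f +ₚ g)) (≋-trans (*ₚ-distribʳ h f g) (+ₚ-cong (*ₚ-comm f h) (*ₚ-comm g h)))

  ·ₚ-*ₚ : ∀ a f g → (a ·ₚ f) *ₚ g ≋ a ·ₚ (f *ₚ g)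
  ·ₚ-*ₚ a []      g = ≋-refl
  ·ₚ-*ₚ a (b ∷ f) g = begin
    (a * b) ·ₚ g +ₚ (0# ∷ (a ·ₚ f) *ₚ g)   ≈⟨ +ₚ-cong (≋-sym (·ₚ-assoc a b g)) (∷-cong (sym (zeroʳ a)) (·ₚ-*ₚ a f g)) ⟩
    a ·ₚ b ·ₚ g +ₚ a ·ₚ (0# ∷ f *ₚ g)      ≈⟨ ·ₚ-distribˡ a (b ·ₚ g) _ ⟨
    a ·ₚ (b ·ₚ g +ₚ (0# ∷ f *ₚ g))         ∎
    where open SetoidReasoning ≋-setoid

  0∷-*ₚ : ∀ f g → (0# ∷ f) *ₚ g ≋ 0# ∷ f *ₚ g
  0∷-*ₚ f g = +ₚ-cong (·ₚ-zeroˡ g) ≋-refl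

  *ₚ-assoc : ∀ f g h → (f *ₚ g) *ₚ h ≋ f *ₚ (g *ₚ h)
  *ₚ-assoc []      g h = ≋-refl
  *ₚ-assoc (a ∷ f) g h = begin
    (a ·ₚ g +ₚ (0# ∷ f *ₚ g)) *ₚ h          ≈⟨ *ₚ-distribʳ h (a ·ₚ g) _ ⟩
    ((a ·ₚ g) *ₚ h) +ₚ ((0# ∷ f *ₚ g) *ₚ h)    ≈⟨ +ₚ-cong (·ₚ-*ₚ a g h) (0∷-*ₚ (f *ₚ g) h) ⟩
    a ·ₚ (g *ₚ h) +ₚ (0# ∷ (f *ₚ g) *ₚ h)   ≈⟨ +ₚ-cong ≋-refl (∷-cong refl (*ₚ-assoc f g h)) ⟩
    a ·ₚ (g *ₚ h) +ₚ (0# ∷ f *ₚ (g *ₚ h))   ∎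
    where open SetoidReasoning ≋-setoid

  *ₚ-identityˡ : ∀ f → oneₚ *ₚ f ≋ f
  *ₚ-identityˡ f = ≋-trans (+ₚ-cong (·ₚ-identityˡ f) (0∷≋[] ≋-refl)) (+ₚ-identityʳ f)

  Poly-isCommutativeRing : IsCommutativeRing _≋_ _+ₚ_ _*ₚ_ negₚ [] oneₚ
  Poly-isCommutativeRing = record
    { isRing = record
      { +-isAbelianGroup = +ₚ-isAbelianGroup
      ; *-cong           = λ {f} {f′} {g} {g′} f≋f′ g≋g′ → ≋-trans (*ₚ-congʳ g f≋f′) (*ₚ-congˡ f′ g≋g′)
      ; *-assoc          = *ₚ-assoc
      ; *-identity       = *ₚ-identityˡ , λ f → ≋-trans (*ₚ-comm f oneₚ) (*ₚ-identityˡ f)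
      ; distrib          = *ₚ-distribˡ , *ₚ-distribʳ
      }
    ; *-comm = *ₚ-comm
    }

  Poly-commutativeRing : CommutativeRing c ℓ
  Poly-commutativeRing = record { isCommutativeRing = Poly-isCommutativeRing }

  open import Algebra.Properties.AbelianGroup +ₚ-abelianGroup using (\\-leftDividesˡ; x∙y⁻¹≈ε⇒x≈y)
  open CommutativeRingDivisibility Poly-commutativeRing

  ∣ₚ⇒∣ : ∀ {d f} → d ∣ₚ f → d ∣ f
  ∣ₚ⇒∣ (e , f≈ₚed) = e , ≋-sym (≈ₚ⇒≋ f≈ₚed)

  ∣⇒∣ₚ : ∀ {d f} → d ∣ f → d ∣ₚ f
  ∣⇒∣ₚ (e , ed≋f) = e , ≋⇒≈ₚ (≋-sym ed≋f)

  coeff-length≤ : ∀ f {k} → length f ≤ k → coeff f k ≡ 0#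
  coeff-length≤ []      _         = ≡.refl
  coeff-length≤ (a ∷ f) (s≤s f≤k) = coeff-length≤ f f≤k

  module _ {m} (w : Vec Carrier m) (lc : Carrier) where

    coeff-lead : coeff (toList w ++ [ lc ]) m ≡ lc
    coeff-lead = go w
      where
      go : ∀ {m} (w : Vec Carrier m) → coeff (toList w ++ [ lc ]) m ≡ lc
      go []      = ≡.refl
      go (_ ∷ w) = go w

    coeff-above-lead : ∀ {k} → m < k → coeff (toList w ++ [ lc ]) k ≡ 0#
    coeff-above-lead = go w
      where
      go : ∀ {m k} (w : Vec Carrier m) → m < k → coeff (toList w ++ [ lc ]) k ≡ 0#
      go {k = suc k} []      _         = ≡.refl
      go {k = suc k} (_ ∷ w) (s≤s m<k) = go w m<k

  length-poly : ∀ (A : Monic) → length (poly A) ≡ suc (deg A)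
  length-poly (d , v) = go v
    where
    go : ∀ {d} (v : Vec Carrier d) → length (toList v ++ [ 1# ]) ≡ suc d
    go []      = ≡.refl
    go (_ ∷ v) = ≡.cong suc (go v)

  -- Division with remainder and Bézout's identity

  truncate : (m : ℕ) → Poly → Vec Carrier m
  truncate zero    _       = []
  truncate (suc m) []      = 0# ∷ truncate m []
  truncate (suc m) (a ∷ f) = a ∷ truncate m f

  truncate-≋ : ∀ m f → f ≋ [] from m → toList (truncate m f) ≋ f
  truncate-≋ zero    f       f≈0 = mk≋ λ k → sym (f≈0 k z≤n)
  truncate-≋ (suc m) []      _   = 0∷≋[] (truncate-≋ m [] λ _ _ → refl)
  truncate-≋ (suc m) (a ∷ f) f≈0 = ∷-cong refl (truncate-≋ m f λ k m≤k → f≈0 (suc k) (s≤s m≤k))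

  module Division {m} (w : Vec Carrier m) {lc lc⁻¹} (lc*lc⁻¹≈1 : lc * lc⁻¹ ≈ 1#) where

    g : Poly
    g = toList w ++ [ lc ]

    reduce : (s : Vec Carrier (suc m)) → ∃₂ λ t (r : Vec Carrier m) → toList s ≋ t ·ₚ g +ₚ toList r
    reduce s = t , truncate m rest , ≋-trans (≋-sym (\\-leftDividesˡ (t ·ₚ g) (toList s)))
                                             (+ₚ-cong ≋-refl (≋-sym (truncate-≋ m rest rest-vanishes)))
      where
      t : Carrier
      t = coeff (toList s) m * lc⁻¹
      rest : Poly
      rest = negₚ (t ·ₚ g) +ₚ toList s
      coeff-rest : ∀ k → coeff rest k ≈ - (t * coeff g k) + coeff (toList s) k
      coeff-rest k = trans (coeff-+ₚ (negₚ (t ·ₚ g)) (toList s) k)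
                           (+-congʳ (trans (coeff-negₚ (t ·ₚ g) k) (-‿cong (coeff-·ₚ t g k))))
      rest-vanishes : rest ≋ [] from m
      rest-vanishes k m≤k with m ℕ.≟ k
      ... | yes ≡.refl = trans (coeff-rest m) (begin
        - (t * coeff g m) + coeff (toList s) m  ≈⟨ +-congʳ (-‿cong (*-congˡ (reflexive (coeff-lead w lc)))) ⟩
        - (t * lc) + coeff (toList s) m         ≈⟨ +-congʳ (-‿cong t*lc≈s) ⟩
        - coeff (toList s) m + coeff (toList s) m ≈⟨ -‿inverseˡ _ ⟩
        0#                                      ∎)
        where
        open SetoidReasoning setoid
        t*lc≈s : t * lc ≈ coeff (toList s) m
        t*lc≈s = trans (*-assoc _ lc⁻¹ lc) (trans (*-congˡ (trans (*-comm lc⁻¹ lc) lc*lc⁻¹≈1)) (*-identityʳ _))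
      ... | no m≢k = trans (coeff-rest k) (trans
        (+-cong (-‿cong (trans (*-congˡ (reflexive (coeff-above-lead w lc m<k))) (zeroʳ t)))
                (reflexive (coeff-length≤ (toList s) (≤-trans (≤-reflexive (length-toList s)) m<k))))
        (trans (+-identityʳ _) -0#≈0#))
        where m<k = ≤∧≢⇒< m≤k m≢k

    divide : ∀ f → ∃₂ λ Q (r : Vec Carrier m) → f ≋ (Q *ₚ g) +ₚ toList r
    divide []      = [] , truncate m [] , ≋-sym (truncate-≋ m [] λ _ _ → refl)
    divide (a ∷ f) with divide f
    ... | Q , r , f≋Qg+r with reduce (a ∷ r)
    ...   | t , r′ , ar≋tg+r′ = t ∷ Q , r′ , (begin
      a ∷ f                                       ≈⟨ ∷-cong (sym (+-identityˡ a)) f≋Qg+r ⟩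
      (0# ∷ Q *ₚ g) +ₚ (a ∷ toList r)             ≈⟨ +ₚ-cong (≋-refl {0# ∷ Q *ₚ g}) ar≋tg+r′ ⟩
      (0# ∷ Q *ₚ g) +ₚ (t ·ₚ g +ₚ toList r′)      ≈⟨ +ₚ-assoc (0# ∷ Q *ₚ g) (t ·ₚ g) (toList r′) ⟨
      ((0# ∷ Q *ₚ g) +ₚ t ·ₚ g) +ₚ toList r′      ≈⟨ +ₚ-cong (+ₚ-comm (0# ∷ Q *ₚ g) (t ·ₚ g)) ≋-refl ⟩
      (t ·ₚ g +ₚ (0# ∷ Q *ₚ g)) +ₚ toList r′      ∎)
      where open SetoidReasoning ≋-setoid

  NonzeroOfDegree< : ℕ → Poly → Set (c ⊔ ℓ)
  NonzeroOfDegree< m f = ∃ λ d → d < m × ∃₂ λ (w : Vec Carrier d) lc → ¬ lc ≈ 0# × f ≋ toList w ++ [ lc ]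

  normalise : ∀ {m} (r : Vec Carrier m) → toList r ≋ [] ⊎ NonzeroOfDegree< m (toList r)
  normalise [] = inj₁ ≋-refl
  normalise (a ∷ r) with normalise r
  ... | inj₂ (d , d<m , w , lc , lc≉0 , r≋wlc) = inj₂ (suc d , s≤s d<m , a ∷ w , lc , lc≉0 , ∷-cong refl r≋wlc)
  ... | inj₁ r≋[] with a ≟ 0#
  ...   | yes a≈0 = inj₁ (≋-trans (∷-cong a≈0 r≋[]) (0∷≋[] ≋-refl))
  ...   | no  a≉0 = inj₂ (0 , s≤s z≤n , [] , a , a≉0 , ∷-cong refl r≋[])

  bezout : ∀ {m} (w : Vec Carrier m) {lc} → ¬ lc ≈ 0# → ∀ f →
           Coprime f (toList w ++ [ lc ]) → Combination f (toList w ++ [ lc ]) oneₚ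
  bezout {m} = go (<-wellFounded m)
    where
    go : ∀ {m} → Acc _<_ m → (w : Vec Carrier m) {lc : Carrier} → ¬ lc ≈ 0# → ∀ f →
         Coprime f (toList w ++ [ lc ]) → Combination f (toList w ++ [ lc ]) oneₚ
    go (acc smaller) w {lc} lc≉0 f coprime
      with lc⁻¹ , lc*lc⁻¹≈1 ← inverse lc lc≉0
      with Q , r , f≋Qg+r ← Division.divide w lc*lc⁻¹≈1 f
      with normalise r
    ... | inj₁ r≋[] = let e , eg≋1 = coprime g∣f ∣ʳ-refl in [] , e , eg≋1
      where
      g∣f : (toList w ++ [ lc ]) ∣ f
      g∣f = Q , ≋-sym (≋-trans f≋Qg+r (≋-trans (+ₚ-cong ≋-refl r≋[]) (+ₚ-identityʳ _)))
    ... | inj₂ (d , d<m , w′ , lc′ , lc′≉0 , r≋g′) =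
      euclid-combination {q = Q} division (go (smaller d<m) w′ lc′≉0 _ (euclid-coprime {q = Q} division coprime))
      where
      division : f ≋ (Q *ₚ (toList w ++ [ lc ])) +ₚ (toList w′ ++ [ lc′ ])
      division = ≋-trans f≋Qg+r (+ₚ-cong ≋-refl r≋g′)

  -- Monic polynomials and their coefficients

  coeff-∷-*ₚ : ∀ e E g k → coeff ((e ∷ E) *ₚ g) k ≈ e * coeff g k + coeff (0# ∷ E *ₚ g) k
  coeff-∷-*ₚ e E g k = trans (coeff-+ₚ (e ·ₚ g) (0# ∷ E *ₚ g) k) (+-congʳ (coeff-·ₚ e g k))

  low-multiple-of-monic⇒≋[] : ∀ (F : Monic) E → E *ₚ poly F ≋ [] from deg F → E ≋ []
  low-multiple-of-monic⇒≋[] F       []      _     = ≋-refl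
  low-multiple-of-monic⇒≋[] (f , v) (e ∷ E) eF≈0 = ≋-trans (∷-cong e≈0 E≋[]) (0∷≋[] ≋-refl)
    where
    open SetoidReasoning setoid
    F = toList v ++ [ 1# ]
    E≋[] : E ≋ []
    E≋[] = low-multiple-of-monic⇒≋[] (f , v) E λ k f≤k → begin
      coeff (E *ₚ F) k                             ≈⟨ +-identityˡ _ ⟨
      0# + coeff (E *ₚ F) k
        ≈⟨ +-congʳ (trans (*-congˡ (reflexive (coeff-above-lead v 1# (s≤s f≤k)))) (zeroʳ e)) ⟨
      e * coeff F (suc k) + coeff (E *ₚ F) k       ≈⟨ coeff-∷-*ₚ e E F (suc k) ⟨
      coeff ((e ∷ E) *ₚ F) (suc k)                 ≈⟨ eF≈0 (suc k) (ℕ.m≤n⇒m≤1+n f≤k) ⟩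
      0#                                           ∎
    e≈0 : e ≈ 0#
    e≈0 = begin
      e                                            ≈⟨ *-identityʳ e ⟨
      e * 1#                                       ≈⟨ +-identityʳ _ ⟨
      e * 1# + 0#
        ≈⟨ +-cong (*-congˡ (reflexive (coeff-lead v 1#))) (coeff-≈ (0∷≋[] (*ₚ-congʳ F E≋[])) f) ⟨
      e * coeff F f + coeff (0# ∷ E *ₚ F) f        ≈⟨ coeff-∷-*ₚ e E F f ⟨
      coeff ((e ∷ E) *ₚ F) f                       ≈⟨ eF≈0 f ℕ.≤-refl ⟩
      0#                                           ∎

  monic∣-low⇒≋[] : ∀ (F : Monic) {f} → poly F ∣ f → f ≋ [] from deg F → f ≋ []
  monic∣-low⇒≋[] F (E , EF≋f) f≈0 =
    ≋-trans (≋-sym EF≋f) (*ₚ-congʳ (poly F) (low-multiple-of-monic⇒≋[] F E λ k F≤k →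
      trans (coeff-≈ EF≋f k) (f≈0 k F≤k)))

  ≡-mod-monic⇒≋ : ∀ (F : Monic) {f g} → f ≡ g [mod poly F ] → f ≋ g from deg F → f ≋ g
  ≡-mod-monic⇒≋ F {f} {g} (mk≡mod F∣f-g) f≈g = x∙y⁻¹≈ε⇒x≈y f g (monic∣-low⇒≋[] F F∣f-g λ k F≤k →
    trans (coeff-+ₚ f (negₚ g) k)
          (trans (+-congˡ (coeff-negₚ g k)) (trans (+-congʳ (f≈g k F≤k)) (-‿inverseʳ _))))

  coeff-*ₚ-beyond : ∀ f g {k} → length f ℕ.+ length g ≤ suc k → coeff (f *ₚ g) k ≈ 0#
  coeff-*ₚ-beyond []      g _  = refl
  coeff-*ₚ-beyond (a ∷ f) g {k} fg≤k = trans (coeff-∷-*ₚ a f g k) (trans (+-cong a*g≈0 (rest k fg≤k)) (+-identityˡ 0#))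
    where
    a*g≈0 : a * coeff g k ≈ 0#
    a*g≈0 = trans (*-congˡ (reflexive (coeff-length≤ g (ℕ.≤-pred (≤-trans (s≤s (ℕ.m≤n+m _ (length f))) fg≤k)))))
                  (zeroʳ a)
    rest : ∀ k → suc (length f ℕ.+ length g) ≤ suc k → coeff (0# ∷ f *ₚ g) k ≈ 0#
    rest zero    _          = refl
    rest (suc k) (s≤s fg≤k) = coeff-*ₚ-beyond f g fg≤k

  window : Poly → ℕ → (n : ℕ) → Fin n → Carrier
  window f s n i = coeff f (s ℕ.+ Fin.toℕ i)

  window-≈ : ∀ {f g s d} → (∀ i → window f s (d ∸ s) i ≈ window g s (d ∸ s) i) →
    ∀ k → s ≤ k → k < d → coeff f k ≈ coeff g k
  window-≈ {f} {g} {s} same k s≤k k<d =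
    ≡.subst (λ j → coeff f j ≈ coeff g j)
            (≡.trans (≡.cong (s ℕ.+_) (Fin.toℕ-fromℕ< k∸s<d∸s)) (ℕ.m+[n∸m]≡n s≤k))
            (same (Fin.fromℕ< k∸s<d∸s))
    where
    k∸s<d∸s = ℕ.∸-monoˡ-< k<d s≤k

  pairCode : ∀ {m n} → (Fin m → Carrier) → (Fin n → Carrier) → Fin (q ^ m ℕ.* q ^ n)
  pairCode u v = Fin.combine (encode u) (encode v)

  pairCode-injective : ∀ {m n} {u u′ : Fin m → Carrier} {v v′ : Fin n → Carrier} →
    pairCode u v ≡ pairCode u′ v′ → (∀ i → u i ≈ u′ i) × (∀ i → v i ≈ v′ i)
  pairCode-injective {u = u} {u′} {v} {v′} same =
    encode-injective (Fin.combine-injectiveˡ (encode u) (encode v) (encode u′) (encode v′) same) ,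
    encode-injective (Fin.combine-injectiveʳ (encode u) (encode v) (encode u′) (encode v′) same)

  window-≈⇒monic-≋-from : ∀ (A A′ : Monic) {d s} → deg A ≡ d → deg A′ ≡ d →
    (∀ i → window (poly A) s (d ∸ s) i ≈ window (poly A′) s (d ∸ s) i) → poly A ≋ poly A′ from s
  window-≈⇒monic-≋-from (d , v) (.d , v′) ≡.refl ≡.refl same k s≤k with ℕ.<-cmp k d
  ... | tri< k<d _ _    = window-≈ {toList v ++ [ 1# ]} {toList v′ ++ [ 1# ]} same k s≤k k<d
  ... | tri≈ _ ≡.refl _ = reflexive (≡.trans (coeff-lead v 1#) (≡.sym (coeff-lead v′ 1#)))
  ... | tri> _ _ d<k    = reflexive (≡.trans (coeff-above-lead v 1# d<k) (≡.sym (coeff-above-lead v′ 1# d<k)))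

  length*q^f≤q^e : ∀ {len m n f e} → len ≤ q ^ m ℕ.* q ^ n → m ℕ.+ (n ℕ.+ f) ≤ e → len ℕ.* q ^ f ≤ q ^ e
  length*q^f≤q^e {len} {m} {n} {f} {e} len≤ exponent≤ = begin
    len ℕ.* q ^ f                 ≤⟨ ℕ.*-monoˡ-≤ (q ^ f) len≤ ⟩
    q ^ m ℕ.* q ^ n ℕ.* q ^ f     ≡⟨ ℕ.*-assoc (q ^ m) (q ^ n) (q ^ f) ⟩
    q ^ m ℕ.* (q ^ n ℕ.* q ^ f)   ≡⟨ ≡.cong (q ^ m ℕ.*_) (ℕ.^-distribˡ-+-* q n f) ⟨
    q ^ m ℕ.* q ^ (n ℕ.+ f)       ≡⟨ ℕ.^-distribˡ-+-* q m (n ℕ.+ f) ⟨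
    q ^ (m ℕ.+ (n ℕ.+ f))         ≤⟨ ℕ.^-monoʳ-≤ q {{ℕ.>-nonZero 0<q}} exponent≤ ⟩
    q ^ e                         ∎
    where open ℕ.≤-Reasoning

  module AdmissiblePairs (F H R : Monic) (F∣R : poly F ∣ₚ poly R) (z : ℕ) where

    Pair : Set c
    Pair = Monic × Monic

    Adm : Pair → Set (c ⊔ ℓ)
    Adm = Admissible F H R z

    f h : ℕ
    f = deg F
    h = deg H

    congruence : ∀ A B → Adm (A , B) → (poly A *ₚ poly H) ≡ poly B [mod poly F ]
    congruence _ _ (_ , AH≡B , _) = mk≡mod (∣ₚ⇒∣ AH≡B)

    bezout-F-H : ∀ A B → Adm (A , B) → Combination (poly F) (poly H) oneₚ
    bezout-F-H A B (_ , _ , _ , coprime) = bezout (proj₂ H) 1≉0 (poly F) λ d∣F d∣H →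
      ∣ₚ⇒∣ (coprime _ (∣⇒∣ₚ (x∣ʳy⇒x∣ʳzy (poly A *ₚ poly B) d∣H)) (∣⇒∣ₚ (∣ʳ-trans d∣F (∣ₚ⇒∣ F∣R))))

    degB≡z∸a : ∀ A B {a} → Adm (A , B) → deg A ≡ a → deg B ≡ z ∸ a
    degB≡z∸a A B (degAB≡z , _) ≡.refl = ≡.trans (≡.sym (ℕ.m+n∸m≡n (deg A) (deg B))) (≡.cong (_∸ deg A) degAB≡z)

    degA≤z : ∀ A B → Adm (A , B) → deg A ≤ z
    degA≤z A B (degAB≡z , _) = ≡.subst (deg A ≤_) degAB≡z (ℕ.m≤m+n (deg A) (deg B))

    -- Otherwise AH and B both have degree < deg F, and F ∣ AH - B would force AH = B.
    f≤degA+h : ∀ A B → Adm (A , B) → deg B < f → f ≤ deg A ℕ.+ h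
    f≤degA+h A B adm@(_ , _ , AH≉B , _) degB<f with f ℕ.≤? deg A ℕ.+ h
    ... | yes f≤ = f≤
    ... | no  f≰ = contradiction (≋⇒≈ₚ (≡-mod-monic⇒≋ F (congruence A B adm) λ k f≤k →
                                   trans (AH≈0 k f≤k) (sym (B≈0 k f≤k)))) AH≉B
      where
      AH≈0 : poly A *ₚ poly H ≋ [] from f
      AH≈0 k f≤k = coeff-*ₚ-beyond (poly A) (poly H) (begin
        length (poly A) ℕ.+ length (poly H) ≡⟨ ≡.cong₂ ℕ._+_ (length-poly A) (length-poly H) ⟩
        suc (deg A) ℕ.+ suc h               ≡⟨ ≡.cong suc (ℕ.+-suc (deg A) h) ⟩
        suc (suc (deg A ℕ.+ h))             ≤⟨ s≤s (≤-trans (ℕ.≰⇒> f≰) f≤k) ⟩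
        suc k                               ∎)
        where open ℕ.≤-Reasoning
      B≈0 : poly B ≋ [] from f
      B≈0 k f≤k = reflexive (coeff-above-lead (proj₂ B) 1# (ℕ.<-≤-trans degB<f f≤k))

    module _ (a : ℕ) where

      b : ℕ
      b = z ∸ a

      InClass : Pred Pair (c ⊔ ℓ)
      InClass = Adm ∩ (λ x → deg (proj₁ x) ≡ a)

      HighSecond : Pred Pair 0ℓ
      HighSecond x = f ≤ deg (proj₂ x)

      degB≡b : ∀ x → InClass x → deg (proj₂ x) ≡ b
      degB≡b (A , B) (adm , degA) = degB≡z∸a A B adm degA

      a+b≡z : ∀ x → InClass x → a ℕ.+ b ≡ z
      a+b≡z (A , B) (adm , ≡.refl) = ℕ.m+[n∸m]≡n (degA≤z A B adm)

      code≥ : Pair → Fin (q ^ a ℕ.* q ^ (b ∸ f))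
      code≥ (A , B) = pairCode (window (poly A) 0 a) (window (poly B) f (b ∸ f))

      separates≥ : ∀ {x y} → (InClass ∩ HighSecond) x → (InClass ∩ HighSecond) y →
                   code≥ x ≡ code≥ y → ¬ DistinctPair x y
      separates≥ {A , B} {A′ , B′} (x∈@(adm , degA) , _) (y∈@(adm′ , degA′) , _) same distinct =
        distinct (≋⇒≈ₚ A≋A′ , ≋⇒≈ₚ B≋B′)
        where
        windows = pairCode-injective same
        A≋A′ : poly A ≋ poly A′
        A≋A′ = mk≋ λ k → window-≈⇒monic-≋-from A A′ degA degA′ (proj₁ windows) k z≤n
        B≡B′ : poly B ≡ poly B′ [mod poly F ]
        B≡B′ = ≡-mod-trans (≡-mod-sym (congruence A B adm))
                           (≡-mod-respˡ (*ₚ-congʳ (poly H) (≋-sym A≋A′)) (congruence A′ B′ adm′))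
        B≋B′ : poly B ≋ poly B′
        B≋B′ = ≡-mod-monic⇒≋ F B≡B′
                 (window-≈⇒monic-≋-from B B′ (degB≡b (A , B) x∈) (degB≡b (A′ , B′) y∈) (proj₂ windows))

      bound≥ : ∀ {ys} → AllPairs DistinctPair ys → All (InClass ∩ HighSecond) ys →
               length ys ℕ.* q ^ f ≤ q ^ (z ℕ.+ h)
      bound≥ []        []                    = z≤n
      bound≥ {x ∷ _} Rys@(_ ∷ _) Pys@((x∈ , f≤degB) ∷ _) =
        length*q^f≤q^e {m = a} {b ∸ f} (separating-code⇒length≤ code≥ separates≥ Rys Pys) (begin
          a ℕ.+ (b ∸ f ℕ.+ f) ≤⟨ ℕ.+-monoʳ-≤ a (m∸n+n≤o ℕ.≤-refl (≡.subst (f ≤_) (degB≡b x x∈) f≤degB)) ⟩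
          a ℕ.+ b             ≡⟨ a+b≡z x x∈ ⟩
          z                   ≤⟨ ℕ.m≤m+n z h ⟩
          z ℕ.+ h             ∎)
        where open ℕ.≤-Reasoning

      code< : Pair → Fin (q ^ b ℕ.* q ^ (a ∸ f))
      code< (A , B) = pairCode (window (poly B) 0 b) (window (poly A) f (a ∸ f))

      separates< : ∀ {x y} → (InClass ∩ ∁ HighSecond) x → (InClass ∩ ∁ HighSecond) y →
                   code< x ≡ code< y → ¬ DistinctPair x y
      separates< {A , B} {A′ , B′} (x∈@(adm , degA) , _) (y∈@(adm′ , degA′) , _) same distinct =
        distinct (≋⇒≈ₚ A≋A′ , ≋⇒≈ₚ B≋B′)
        where
        windows = pairCode-injective same
        B≋B′ : poly B ≋ poly B′
        B≋B′ = mk≋ λ k → window-≈⇒monic-≋-from B B′ (degB≡b (A , B) x∈) (degB≡b (A′ , B′) y∈) (proj₁ windows) k z≤n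
        AH≡A′H : (poly A *ₚ poly H) ≡ (poly A′ *ₚ poly H) [mod poly F ]
        AH≡A′H = ≡-mod-trans (congruence A B adm) (≡-mod-sym (≡-mod-respʳ (≋-sym B≋B′) (congruence A′ B′ adm′)))
        A≋A′ : poly A ≋ poly A′
        A≋A′ = ≡-mod-monic⇒≋ F (≡-mod-cancelʳ (bezout-F-H A B adm) AH≡A′H)
                 (window-≈⇒monic-≋-from A A′ degA degA′ (proj₂ windows))

      bound< : ∀ {ys} → AllPairs DistinctPair ys → All (InClass ∩ ∁ HighSecond) ys →
               length ys ℕ.* q ^ f ≤ q ^ (z ℕ.+ h)
      bound< []              []                                  = z≤n
      bound< {(A , B) ∷ _} Rys@(_ ∷ _) Pys@((x∈@(adm , ≡.refl) , f≰degB) ∷ _) =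
        length*q^f≤q^e {m = b} {a ∸ f} (separating-code⇒length≤ code< separates< Rys Pys) (begin
          b ℕ.+ (a ∸ f ℕ.+ f) ≤⟨ ℕ.+-monoʳ-≤ b (m∸n+n≤o (ℕ.m≤m+n a h) (f≤degA+h A B adm (ℕ.≰⇒> f≰degB))) ⟩
          b ℕ.+ (a ℕ.+ h)     ≡⟨ ℕ.+-assoc b a h ⟨
          b ℕ.+ a ℕ.+ h       ≡⟨ ≡.cong (ℕ._+ h) (≡.trans (ℕ.+-comm b a) (a+b≡z (A , B) x∈)) ⟩
          z ℕ.+ h             ∎)
        where open ℕ.≤-Reasoning

    class-bound : ∀ a {ys} → AllPairs DistinctPair ys → All (InClass a) ys →
                  length ys ℕ.* q ^ f ≤ q ^ (z ℕ.+ h) ℕ.+ q ^ (z ℕ.+ h)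
    class-bound a = split-count (λ x → f ℕ.≤? deg (proj₂ x)) (bound≥ a) (bound< a)

    admissible-count : ∀ {L} → AllPairs DistinctPair L → All Adm L →
                       length L ℕ.* q ^ f ≤ suc z ℕ.* (q ^ (z ℕ.+ h) ℕ.+ q ^ (z ℕ.+ h))
    admissible-count RL AL =
      key-count (deg ∘ proj₁) class-bound (suc z) RL (All.map (λ {(A , B)} adm → adm , s≤s (degA≤z A B adm)) AL)

open import Data.Nat using (_+_; _*_)

lemma3p3 : Σ ℕ λ C → (K : FiniteField 0ℓ 0ℓ) → OddPrimePower (FiniteField.size K)
    → (F H R : Over.Monic K) → Over._∣ₚ_ K (Over.poly K F) (Over.poly K R)
    → (z : ℕ) → z < Over.deg K R
    → (L : List (Over.Monic K × Over.Monic K))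
    → AllPairs (Over.DistinctPair K) L
    → All (Over.Admissible K F H R z) L
    → length L * Over.∣_∣ K F ≤ C * (Over.q K ^ z) * (z + 1) * Over.∣_∣ K H
lemma3p3 = 2 , λ K _ F H R F∣R z _ L distinct admissible → let open Over K in begin
  length L * ∣ F ∣                            ≤⟨ admissible-count K F H R F∣R z distinct admissible ⟩
  suc z * (q ^ (z + deg H) + q ^ (z + deg H)) ≡⟨ ≡.cong (λ t → suc z * (t + t)) (ℕ.^-distribˡ-+-* q z (deg H)) ⟩
  suc z * (q ^ z * ∣ H ∣ + q ^ z * ∣ H ∣)     ≡⟨ arithmetic z (q ^ z) ∣ H ∣ ⟩
  2 * q ^ z * (z + 1) * ∣ H ∣                 ∎
  where
  open ℕ.≤-Reasoning
  open Polynomials.AdmissiblePairs using (admissible-count)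
  arithmetic : ∀ z x y → suc z * (x * y + x * y) ≡ 2 * x * (z + 1) * y
  arithmetic = solve-∀
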